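{- Let $K=\mathbb{Q}(\sqrt{d})$, let $p>3$ be a prime, let $\alpha\in\mathbb{Q}$, and let $(X,Y)\in K^2$ satisfy $Y^2=X^p+\alpha$. Then: (a) $X\in\mathbb{Q}$ if and only if $Im(Y)=0$ or $Re(Y)=0$; (b) $X=a+b\sqrt{d}$ with $a,b\in\mathbb{Q}$ and $b\neq 0$ if and only if $Y=m+n\sqrt{d}$ with $m,n\in\mathbb{Q}$ and $mn\neq 0$.
   Context: $d$ is a squarefree integer with $d\neq 0,1$. For an element $a+b\sqrt{d}\in K$ with $a,b\in\mathbb{Q}$, its "real part" is $Re(a+b\sqrt{d})=a$ and its "imaginary part" is $Im(a+b\sqrt{d})=b$ (defined this way for every squarefree $d$). -}

module Defs where

open import Data.Nat as ℕ using (ℕ; zero; suc)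
open import Data.Nat.Divisibility using (_∣_)
open import Data.Integer as ℤ using (ℤ; ∣_∣)
open import Data.Rational using (ℚ; 0ℚ; 1ℚ; _+_; _*_)
open import Data.Product using (_×_; _,_)
open import Relation.Binary.PropositionalEquality using (_≡_; _≢_)

SquareFree : ℤ → Set
SquareFree d = d ≢ ℤ.0ℤ × (∀ (n : ℕ) → (n ℕ.* n) ∣ ∣ d ∣ → n ≡ 1)

record K (d : ℤ) : Set where
  constructor _+_√d
  field
    re : ℚ
    im : ℚ
open K public

ι : {d : ℤ} → ℚ → K d
ι q = q + 0ℚ √d

_⊕_ : {d : ℤ} → K d → K d → K d
(a + b √d) ⊕ (c + e √d) = (a Data.Rational.+ c) + (b Data.Rational.+ e) √d

-- (a + b√d)(c + e√d) = (ac + d·be) + (ae + bc)√d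
_⊗_ : {d : ℤ} → K d → K d → K d
_⊗_ {d} (a + b √d) (c + e √d) =
  ((a * c) Data.Rational.+ ((d Data.Rational./ 1) * (b * e))) + ((a * e) Data.Rational.+ (b * c)) √d

_^K_ : {d : ℤ} → K d → ℕ → K d
x ^K zero = ι 1ℚ
x ^K suc n = x ⊗ (x ^K n)

InQ : {d : ℤ} → K d → Set
InQ X = Data.Product.∃ λ (q : ℚ) → X ≡ ι q

-- Comparing imaginary parts in Y² = Xᵖ + α gives 2 Re(Y) Im(Y) = Im(Xᵖ), so both parts
-- reduce to: for a prime p ≥ 5, Im(Xᵖ) = 0 forces Im(X) = 0. Write X = a + b√d with b ≠ 0
-- and p = 2h + 1. If a = 0 then Xᵖ = b (b²d)ʰ √d. Otherwise X = a (1 + c√d) and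
-- Im(Xᵖ) = aᵖ c R(c²d) with R(t) = Σ_{j≤h} C(p, 2j+1) tʲ. This R is monic of degree h ≥ 2,
-- its lower coefficients are divisible by p and its constant term is p, so Eisenstein's
-- argument rules out a rational root r/s in lowest terms: reducing mod p gives p ∣ r, and
-- then reducing mod p² gives p ∣ s.

module Submission where

open import Defs
open import Data.Nat using (ℕ; _>_)
open import Data.Nat.Primality using (Prime)
open import Data.Integer using (ℤ; 1ℤ)
open import Data.Rational using (ℚ; 0ℚ; _*_)
open import Data.Product using (_×_; Σ; ∃; _,_)
open import Data.Sum using (_⊎_)
open import Function.Bundles using (_⇔_)
open import Relation.Binary.PropositionalEquality using (_≡_; _≢_)

open import Level using (0ℓ)
open import Data.Empty using (⊥-elim)
open import Data.Product using (proj₁; proj₂)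
open import Data.Sum using (inj₁; inj₂; swap)
open import Function using (_∘_)
open import Function.Bundles using (mk⇔; module Equivalence)
open import Function.Properties.Equivalence using (⇔-setoid)
open import Relation.Nullary using (¬_; yes; no)
open import Relation.Nullary.Decidable using (dec⇒maybe; decidable-stable)
open import Relation.Binary.PropositionalEquality
  using (refl; sym; trans; cong; cong₂; subst; module ≡-Reasoning)
import Relation.Binary.Reasoning.Setoid as SetoidReasoning

open import Data.Nat as ℕ using (zero; suc; _<_; _≤_; _∸_; _!; s≤s; z≤n)
import Data.Nat.Properties as ℕ
open import Data.Nat.Properties using (_!*_!≢0)
open import Data.Nat.Divisibility using (_∣_; divides; ∣1⇒≡1; ∣⇒≤; m∣m*n)
open import Data.Nat.DivMod using (m/n*n≡m)
open import Data.Nat.Primality using (euclidsLemma; prime⇒nonZero; prime⇒irreducible; ¬prime[1])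
import Data.Nat.Coprimality as Coprimality
open import Data.Nat.Combinatorics
  using (_C_; nCn≡1; nC1≡n; nCk+nC[k+1]≡[n+1]C[k+1]; k>n⇒nCk≡0; nCk≡n!/k![n-k]!; k![n∸k]!∣n!)
open import Data.Integer as ℤ using (+_; ∣_∣; 0ℤ)
import Data.Integer.Properties as ℤ
import Data.Integer.Divisibility.Signed as ℤ∣
import Data.Integer.Tactic.RingSolver as ℤ-Solver
open import Data.Rational as ℚ using (mkℚ; 1ℚ; _+_; 1/_; ↥_)
import Data.Rational.Properties as ℚ
import Data.Rational.Unnormalised as ℚᵘ
import Data.Rational.Unnormalised.Properties as ℚᵘ
open import Algebra.Definitions.RawSemiring ℚ.+-*-rawSemiring using (_^_)
open import Tactic.RingSolver using (solve-∀)
open import Tactic.RingSolver.Core.AlmostCommutativeRing using (AlmostCommutativeRing; fromCommutativeRing)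

-- A genuine zero test is needed: with `λ _ → nothing` the solver fails on ℚ.
ℚ-ring : AlmostCommutativeRing 0ℓ 0ℓ
ℚ-ring = fromCommutativeRing ℚ.+-*-commutativeRing (λ q → dec⇒maybe (0ℚ ℚ.≟ q))

p*q≡0⇒p≡0∨q≡0 : ∀ p q → p * q ≡ 0ℚ → p ≡ 0ℚ ⊎ q ≡ 0ℚ
p*q≡0⇒p≡0∨q≡0 p q pq≡0 with p ℚ.≟ 0ℚ
... | yes p≡0 = inj₁ p≡0
... | no p≢0 = inj₂ (begin
  q                ≡⟨ sym (ℚ.*-identityˡ q) ⟩
  1ℚ * q           ≡⟨ cong (_* q) (sym (ℚ.*-inverseˡ p)) ⟩
  (1/ p * p) * q   ≡⟨ ℚ.*-assoc (1/ p) p q ⟩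
  1/ p * (p * q)   ≡⟨ cong (1/ p *_) pq≡0 ⟩
  1/ p * 0ℚ        ≡⟨ ℚ.*-zeroʳ (1/ p) ⟩
  0ℚ               ∎)
  where
  open ≡-Reasoning
  instance _ = ℚ.≢-nonZero p≢0

p≢0∧q≢0⇒p*q≢0 : ∀ {p q} → p ≢ 0ℚ → q ≢ 0ℚ → p * q ≢ 0ℚ
p≢0∧q≢0⇒p*q≢0 {p} {q} p≢0 q≢0 pq≡0 with p*q≡0⇒p≡0∨q≡0 p q pq≡0
... | inj₁ p≡0 = p≢0 p≡0
... | inj₂ q≡0 = q≢0 q≡0

p≢0⇒p^n≢0 : ∀ {p} n → p ≢ 0ℚ → p ^ n ≢ 0ℚ
p≢0⇒p^n≢0 zero    p≢0 ()
p≢0⇒p^n≢0 (suc n) p≢0 = p≢0∧q≢0⇒p*q≢0 p≢0 (p≢0⇒p^n≢0 n p≢0)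

p+p≡0⇒p≡0 : ∀ p → p + p ≡ 0ℚ → p ≡ 0ℚ
p+p≡0⇒p≡0 p p+p≡0 = decidable-stable (p ℚ.≟ 0ℚ) λ p≢0 →
  p≢0∧q≢0⇒p*q≢0 {1ℚ + 1ℚ} (λ ()) p≢0 (trans (2*p≡p+p p) p+p≡0)
  where
  2*p≡p+p : ∀ p → (1ℚ + 1ℚ) * p ≡ p + p
  2*p≡p+p = solve-∀ ℚ-ring

p*q≡0⇔q≡0∨p≡0 : ∀ p q → p * q ≡ 0ℚ ⇔ (q ≡ 0ℚ ⊎ p ≡ 0ℚ)
p*q≡0⇔q≡0∨p≡0 p q = mk⇔ (swap ∘ p*q≡0⇒p≡0∨q≡0 p q) λ
  { (inj₁ refl) → ℚ.*-zeroʳ p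
  ; (inj₂ refl) → ℚ.*-zeroˡ q }

-- Unlike i ℚ./ 1, which normalises through a gcd, this is already in normal form.
fromℤ : ℤ → ℚ
fromℤ i = mkℚ i 0 (Coprimality.sym (Coprimality.1-coprimeTo ∣ i ∣))

fromℤ-injective : ∀ {i j} → fromℤ i ≡ fromℤ j → i ≡ j
fromℤ-injective = cong ↥_

fromℤ-+ : ∀ i j → fromℤ (i ℤ.+ j) ≡ fromℤ i + fromℤ j
fromℤ-+ i j = ℚ.toℚᵘ-injective
  (ℚᵘ.≃-sym (ℚᵘ.≃-trans (ℚ.toℚᵘ-homo-+ (fromℤ i) (fromℤ j)) (ℚᵘ.*≡* (eq i j))))
  where
  eq : ∀ i j → (i ℤ.* + 1 ℤ.+ j ℤ.* + 1) ℤ.* + 1 ≡ (i ℤ.+ j) ℤ.* (+ 1 ℤ.* + 1)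
  eq = ℤ-Solver.solve-∀

fromℤ-* : ∀ i j → fromℤ (i ℤ.* j) ≡ fromℤ i * fromℤ j
fromℤ-* i j = ℚ.toℚᵘ-injective (ℚᵘ.≃-sym (ℚ.toℚᵘ-homo-* (fromℤ i) (fromℤ j)))

fromℤ-^ : ∀ i n → fromℤ (i ℤ.^ n) ≡ fromℤ i ^ n
fromℤ-^ i zero    = refl
fromℤ-^ i (suc n) = trans (fromℤ-* i (i ℤ.^ n)) (cong (fromℤ i *_) (fromℤ-^ i n))

fromℤ≡/1 : ∀ i → fromℤ i ≡ i ℚ./ 1
fromℤ≡/1 i = sym (ℚ.↥p/↧p≡p (fromℤ i))

i≢0⇒i/1≢0 : ∀ {i} → i ≢ 0ℤ → i ℚ./ 1 ≢ 0ℚ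
i≢0⇒i/1≢0 {i} i≢0 i/1≡0 = i≢0 (fromℤ-injective (trans (fromℤ≡/1 i) i/1≡0))

t*↧t≡↥t : ∀ t → t * fromℤ (ℚ.↧ t) ≡ fromℤ (↥ t)
t*↧t≡↥t t@(mkℚ n d-1 _) = ℚ.toℚᵘ-injective
  (ℚᵘ.≃-trans (ℚ.toℚᵘ-homo-* t (fromℤ (ℚ.↧ t))) (ℚᵘ.*≡* (eq n (+ suc d-1))))
  where
  eq : ∀ n d → (n ℤ.* d) ℤ.* + 1 ≡ n ℤ.* (d ℤ.* + 1)
  eq = ℤ-Solver.solve-∀

-- Odd numbers are written suc (h ℕ.* 2): (suc h) ℕ.* 2 reduces to suc (suc (h ℕ.* 2)),
-- so recursion on h steps through every second exponent.
even⊎odd : ∀ n → ∃ λ h → n ≡ h ℕ.* 2 ⊎ n ≡ suc (h ℕ.* 2)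
even⊎odd zero = 0 , inj₁ refl
even⊎odd (suc n) with even⊎odd n
... | h , inj₁ n≡2h   = h , inj₂ (cong suc n≡2h)
... | h , inj₂ n≡2h+1 = suc h , inj₁ (cong suc n≡2h+1)

prime>3⇒odd : ∀ {p} → Prime p → p > 3 → ∃ λ h → 2 ≤ h × p ≡ suc (h ℕ.* 2)
prime>3⇒odd {p} pr p>3 with even⊎odd p
... | h , inj₁ p≡2h with prime⇒irreducible pr (divides h p≡2h)
...   | inj₁ ()
...   | inj₂ 2≡p = ⊥-elim (ℕ.<⇒≱ p>3 (ℕ.≤-trans (ℕ.≤-reflexive (sym 2≡p)) (ℕ.n≤1+n 2)))
prime>3⇒odd pr (s≤s ())             | 0 , inj₂ refl
prime>3⇒odd pr (s≤s (s≤s (s≤s ()))) | 1 , inj₂ refl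
prime>3⇒odd pr p>3 | suc (suc h) , inj₂ p≡2h+1 = suc (suc h) , s≤s (s≤s z≤n) , p≡2h+1

prime∤m! : ∀ {p} m → Prime p → m < p → ¬ p ∣ m !
prime∤m! zero    pr _   p∣1  = ¬prime[1] (subst Prime (∣1⇒≡1 p∣1) pr)
prime∤m! (suc m) pr m<p p∣m! with euclidsLemma (suc m) (m !) pr p∣m!
... | inj₁ p∣1+m = ℕ.<⇒≱ m<p (∣⇒≤ p∣1+m)
... | inj₂ p∣m!′ = prime∤m! m pr (ℕ.<⇒≤ m<p) p∣m!′

prime∣pCk : ∀ {p k} → Prime p → 0 < k → k < p → p ∣ p C k
prime∣pCk {p@(suc p-1)} {k} pr 0<k k<p
  with euclidsLemma (p C k) (k ! ℕ.* (p ∸ k) !) pr (subst (p ∣_) p!≡pCk*k!*[p∸k]! (m∣m*n (p-1 !)))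
  where
  instance _ = k !* (p ∸ k) !≢0
  p!≡pCk*k!*[p∸k]! : p ! ≡ (p C k) ℕ.* (k ! ℕ.* (p ∸ k) !)
  p!≡pCk*k!*[p∸k]! = trans (sym (m/n*n≡m (k![n∸k]!∣n! (ℕ.<⇒≤ k<p))))
                           (cong (ℕ._* (k ! ℕ.* (p ∸ k) !)) (sym (nCk≡n!/k![n-k]! (ℕ.<⇒≤ k<p))))
... | inj₁ p∣pCk = p∣pCk
... | inj₂ p∣k!*[p∸k]! with euclidsLemma (k !) ((p ∸ k) !) pr p∣k!*[p∸k]!
...   | inj₁ p∣k!     = ⊥-elim (prime∤m! k pr k<p p∣k!)
...   | inj₂ p∣[p∸k]! = ⊥-elim (prime∤m! (p ∸ k) pr (ℕ.∸-monoʳ-< 0<k (ℕ.<⇒≤ k<p)) p∣[p∸k]!)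

prime∣m^n⇒prime∣m : ∀ {p} m n → Prime p → p ∣ m ℕ.^ n → p ∣ m
prime∣m^n⇒prime∣m m zero    pr p∣1 = ⊥-elim (¬prime[1] (subst Prime (∣1⇒≡1 p∣1) pr))
prime∣m^n⇒prime∣m m (suc n) pr p∣m^[1+n] with euclidsLemma m (m ℕ.^ n) pr p∣m^[1+n]
... | inj₁ p∣m   = p∣m
... | inj₂ p∣m^n = prime∣m^n⇒prime∣m m n pr p∣m^n

∣i^n∣≡∣i∣^n : ∀ i n → ∣ i ℤ.^ n ∣ ≡ ∣ i ∣ ℕ.^ n
∣i^n∣≡∣i∣^n i zero    = refl
∣i^n∣≡∣i∣^n i (suc n) = trans (ℤ.abs-* i (i ℤ.^ n)) (cong (∣ i ∣ ℕ.*_) (∣i^n∣≡∣i∣^n i n))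

i^n+k*p≡0⇒p∣∣i∣ : ∀ {p} i n k → Prime p → i ℤ.^ n ℤ.+ k ℤ.* + p ≡ 0ℤ → p ∣ ∣ i ∣
i^n+k*p≡0⇒p∣∣i∣ {p} i n k pr eq = prime∣m^n⇒prime∣m ∣ i ∣ n pr
  (subst (p ∣_) (∣i^n∣≡∣i∣^n i n) (ℤ∣.∣⇒∣ᵤ p∣i^n))
  where
  p∣i^n : + p ℤ∣.∣ i ℤ.^ n
  p∣i^n = ℤ∣.∣m+n∣n⇒∣m (subst (+ p ℤ∣.∣_) (sym eq) (ℤ∣.divides 0ℤ refl)) (ℤ∣.divides k refl)

eval : (ℕ → ℕ) → ℕ → ℚ → ℚ
eval f zero    t = 0ℚ
eval f (suc N) t = fromℤ (+ f 0) + t * eval (f ∘ suc) N t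

eval-zeros : ∀ N t → eval (λ _ → 0) N t ≡ 0ℚ
eval-zeros zero    t = refl
eval-zeros (suc N) t = trans (cong (λ e → 0ℚ + t * e) (eval-zeros N t)) (lemma t)
  where
  lemma : ∀ t → 0ℚ + t * 0ℚ ≡ 0ℚ
  lemma = solve-∀ ℚ-ring

eval-+ : ∀ {f g h} N t → (∀ j → f j ≡ g j ℕ.+ h j) → eval f N t ≡ eval g N t + eval h N t
eval-+             zero    t f≡g+h = sym (ℚ.+-identityʳ 0ℚ)
eval-+ {f} {g} {h} (suc N) t f≡g+h = begin
  fromℤ (+ f 0) + t * eval (f ∘ suc) N t
    ≡⟨ cong₂ (λ c e → fromℤ (+ c) + t * e) (f≡g+h 0) (eval-+ N t (f≡g+h ∘ suc)) ⟩
  fromℤ (+ (g 0 ℕ.+ h 0)) + t * (eval (g ∘ suc) N t + eval (h ∘ suc) N t)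
    ≡⟨ cong (_+ t * (eval (g ∘ suc) N t + eval (h ∘ suc) N t))
            (trans (cong fromℤ (sym (ℤ.pos-+ (g 0) (h 0)))) (fromℤ-+ (+ g 0) (+ h 0))) ⟩
  (fromℤ (+ g 0) + fromℤ (+ h 0)) + t * (eval (g ∘ suc) N t + eval (h ∘ suc) N t)
    ≡⟨ lemma (fromℤ (+ g 0)) (fromℤ (+ h 0)) t (eval (g ∘ suc) N t) (eval (h ∘ suc) N t) ⟩
  (fromℤ (+ g 0) + t * eval (g ∘ suc) N t) + (fromℤ (+ h 0) + t * eval (h ∘ suc) N t) ∎
  where
  open ≡-Reasoning
  lemma : ∀ g₀ h₀ t G H → (g₀ + h₀) + t * (G + H) ≡ (g₀ + t * G) + (h₀ + t * H)
  lemma = solve-∀ ℚ-ring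

eval-extend : ∀ f N t → f N ≡ 0 → eval f (suc N) t ≡ eval f N t
eval-extend f zero    t f[0]≡0 = trans (cong (λ c → fromℤ (+ c) + t * 0ℚ) f[0]≡0) (eval-zeros 1 t)
eval-extend f (suc N) t f[N]≡0 = cong (λ e → fromℤ (+ f 0) + t * e) (eval-extend (f ∘ suc) N t f[N]≡0)

homogenize : (ℕ → ℕ) → ℕ → ℤ → ℤ → ℤ
homogenize f zero    r s = + f 0
homogenize f (suc m) r s = + f 0 ℤ.* s ℤ.^ suc m ℤ.+ r ℤ.* homogenize (f ∘ suc) m r s

fromℤ-homogenize : ∀ f m {t r s} → t * fromℤ s ≡ fromℤ r →
                   fromℤ (homogenize f m r s) ≡ eval f (suc m) t * fromℤ s ^ m
fromℤ-homogenize f zero    {t} ts≡r = lemma (fromℤ (+ f 0)) t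
  where
  lemma : ∀ a t → a ≡ (a + t * 0ℚ) * 1ℚ
  lemma = solve-∀ ℚ-ring
fromℤ-homogenize f (suc m) {t} {r} {s} ts≡r = begin
  fromℤ (+ f 0 ℤ.* s ℤ.^ suc m ℤ.+ r ℤ.* homogenize (f ∘ suc) m r s)
    ≡⟨ fromℤ-+ (+ f 0 ℤ.* s ℤ.^ suc m) (r ℤ.* h) ⟩
  fromℤ (+ f 0 ℤ.* s ℤ.^ suc m) + fromℤ (r ℤ.* h)
    ≡⟨ cong₂ _+_ (trans (fromℤ-* (+ f 0) (s ℤ.^ suc m)) (cong (a *_) (fromℤ-^ s (suc m))))
                 (trans (fromℤ-* r h) (cong₂ _*_ (sym ts≡r) (fromℤ-homogenize (f ∘ suc) m {t} ts≡r))) ⟩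
  a * S ^ suc m + (t * S) * (eval (f ∘ suc) (suc m) t * S ^ m)
    ≡⟨ lemma a t (eval (f ∘ suc) (suc m) t) S (S ^ m) ⟩
  (a + t * eval (f ∘ suc) (suc m) t) * S ^ suc m ∎
  where
  open ≡-Reasoning
  h : ℤ
  h = homogenize (f ∘ suc) m r s
  a : ℚ
  a = fromℤ (+ f 0)
  S : ℚ
  S = fromℤ s
  lemma : ∀ a t e S Sm → a * (S * Sm) + (t * S) * (e * Sm) ≡ (a + t * e) * (S * Sm)
  lemma = solve-∀ ℚ-ring

homogenize≡r^m+kp : ∀ {p} f m r s → (∀ {j} → j < m → p ∣ f j) → f m ≡ 1 →
                    ∃ λ k → homogenize f m r s ≡ r ℤ.^ m ℤ.+ k ℤ.* + p
homogenize≡r^m+kp f zero r s _ f[0]≡1 = 0ℤ , cong +_ f[0]≡1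
homogenize≡r^m+kp {p} f (suc m) r s p∣f f[m]≡1
  with homogenize≡r^m+kp (f ∘ suc) m r s (p∣f ∘ s≤s) f[m]≡1 | p∣f (s≤s z≤n)
... | k , eq | divides q f[0]≡qp = + q ℤ.* s ℤ.^ suc m ℤ.+ r ℤ.* k , (begin
  + f 0 ℤ.* s ℤ.^ suc m ℤ.+ r ℤ.* homogenize (f ∘ suc) m r s
    ≡⟨ cong₂ (λ c h → c ℤ.* s ℤ.^ suc m ℤ.+ r ℤ.* h) (trans (cong +_ f[0]≡qp) (ℤ.pos-* q p)) eq ⟩
  + q ℤ.* + p ℤ.* s ℤ.^ suc m ℤ.+ r ℤ.* (r ℤ.^ m ℤ.+ k ℤ.* + p)
    ≡⟨ lemma (+ q) (+ p) (s ℤ.^ suc m) r (r ℤ.^ m) k ⟩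
  r ℤ.* r ℤ.^ m ℤ.+ (+ q ℤ.* s ℤ.^ suc m ℤ.+ r ℤ.* k) ℤ.* + p ∎)
  where
  open ≡-Reasoning
  lemma : ∀ q p S r rm k → q ℤ.* p ℤ.* S ℤ.+ r ℤ.* (rm ℤ.+ k ℤ.* p)
                           ≡ r ℤ.* rm ℤ.+ (q ℤ.* S ℤ.+ r ℤ.* k) ℤ.* p
  lemma = ℤ-Solver.solve-∀

eisenstein-homogenize : ∀ {p} f m r s → Prime p → 2 ≤ m → (∀ {j} → j < m → p ∣ f j) →
                        f m ≡ 1 → f 0 ≡ p → homogenize f m r (+ s) ≡ 0ℤ → (p ∣ ∣ r ∣) × (p ∣ s)
eisenstein-homogenize {p} f m@(suc m-1@(suc m-2)) r s pr (s≤s (s≤s z≤n)) p∣f f[m]≡1 f[0]≡p H≡0 =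
  p∣r , i^n+k*p≡0⇒p∣∣i∣ S m W pr
          (ℤ.*-cancelˡ-≡ P _ 0ℤ (trans (sym H≡p[s^m+Wp]) (trans H≡0 (sym (ℤ.*-zeroʳ P)))))
  where
  P : ℤ
  P = + p
  S : ℤ
  S = + s
  instance _ = prime⇒nonZero pr

  p∣r : p ∣ ∣ r ∣
  p∣r with homogenize≡r^m+kp f m r S p∣f f[m]≡1
  ... | k , H≡r^m+kp = i^n+k*p≡0⇒p∣∣i∣ r m k pr (trans (sym H≡r^m+kp) H≡0)

  P∣r : P ℤ∣.∣ r
  P∣r = ℤ∣.∣ᵤ⇒∣ {P} {r} p∣r

  ρ : ℤ
  ρ = ℤ∣.quotient P∣r

  k : ℤ
  k = proj₁ (homogenize≡r^m+kp (f ∘ suc) m-1 r S (p∣f ∘ s≤s) f[m]≡1)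

  W : ℤ
  W = ρ ℤ.* (ρ ℤ.* r ℤ.^ m-2) ℤ.+ ρ ℤ.* k

  -- Once p ∣ r, every term but p·sᵐ is divisible by p²; for the term rᵐ this needs m ≥ 2.
  H≡p[s^m+Wp] : homogenize f m r S ≡ P ℤ.* (S ℤ.^ m ℤ.+ W ℤ.* P)
  H≡p[s^m+Wp] = begin
    + f 0 ℤ.* S ℤ.^ m ℤ.+ r ℤ.* homogenize (f ∘ suc) m-1 r S
      ≡⟨ cong₂ (λ c h → + c ℤ.* S ℤ.^ m ℤ.+ r ℤ.* h) f[0]≡p
               (proj₂ (homogenize≡r^m+kp (f ∘ suc) m-1 r S (p∣f ∘ s≤s) f[m]≡1)) ⟩
    P ℤ.* S ℤ.^ m ℤ.+ r ℤ.* (r ℤ.* r ℤ.^ m-2 ℤ.+ k ℤ.* P)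
      ≡⟨ cong (λ x → P ℤ.* S ℤ.^ m ℤ.+ x ℤ.* (x ℤ.* r ℤ.^ m-2 ℤ.+ k ℤ.* P))
              (ℤ∣._∣_.equality P∣r) ⟩
    P ℤ.* S ℤ.^ m ℤ.+ (ρ ℤ.* P) ℤ.* ((ρ ℤ.* P) ℤ.* r ℤ.^ m-2 ℤ.+ k ℤ.* P)
      ≡⟨ lemma P (S ℤ.^ m) ρ (r ℤ.^ m-2) k ⟩
    P ℤ.* (S ℤ.^ m ℤ.+ W ℤ.* P) ∎
    where
    open ≡-Reasoning
    lemma : ∀ P S ρ R k → P ℤ.* S ℤ.+ (ρ ℤ.* P) ℤ.* ((ρ ℤ.* P) ℤ.* R ℤ.+ k ℤ.* P)
                         ≡ P ℤ.* (S ℤ.+ (ρ ℤ.* (ρ ℤ.* R) ℤ.+ ρ ℤ.* k) ℤ.* P)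
    lemma = ℤ-Solver.solve-∀

eisenstein : ∀ {p} f m → Prime p → 2 ≤ m → (∀ {j} → j < m → p ∣ f j) → f m ≡ 1 → f 0 ≡ p →
             ∀ t → eval f (suc m) t ≢ 0ℚ
eisenstein {p} f m pr 2≤m p∣f f[m]≡1 f[0]≡p t@(mkℚ r s-1 r⊥s) eval≡0 =
  let p∣r , p∣s = eisenstein-homogenize f m r (suc s-1) pr 2≤m p∣f f[m]≡1 f[0]≡p H≡0
  in ¬prime[1] (subst Prime (Coprimality.recompute r⊥s (p∣r , p∣s)) pr)
  where
  S : ℚ
  S = fromℤ (+ suc s-1)
  H≡0 : homogenize f m r (+ suc s-1) ≡ 0ℤ
  H≡0 = fromℤ-injective (begin
    fromℤ (homogenize f m r (+ suc s-1)) ≡⟨ fromℤ-homogenize f m (t*↧t≡↥t t) ⟩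
    eval f (suc m) t * S ^ m             ≡⟨ cong (_* S ^ m) eval≡0 ⟩
    0ℚ * S ^ m                           ≡⟨ ℚ.*-zeroˡ (S ^ m) ⟩
    0ℚ                                   ∎)
    where open ≡-Reasoning

evenBinomials oddBinomials : ℕ → ℕ → ℕ
evenBinomials n j = n C (j ℕ.* 2)
oddBinomials  n j = n C suc (j ℕ.* 2)

oddBinomials-suc : ∀ n N t →
  eval (oddBinomials (suc n)) N t ≡ eval (evenBinomials n) N t + eval (oddBinomials n) N t
oddBinomials-suc n N t = eval-+ N t (λ j → sym (nCk+nC[k+1]≡[n+1]C[k+1] n (j ℕ.* 2)))

evenBinomials-suc : ∀ n M t → n ≤ M ℕ.* 2 →
  eval (evenBinomials (suc n)) (suc M) t ≡ eval (evenBinomials n) (suc M) t + t * eval (oddBinomials n) (suc M) t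
evenBinomials-suc n M t n≤2M = begin
  1ℚ + t * eval (evenBinomials (suc n) ∘ suc) M t
    ≡⟨ cong (λ e → 1ℚ + t * e) (eval-+ M t (λ j → sym (nCk+nC[k+1]≡[n+1]C[k+1] n (suc (j ℕ.* 2))))) ⟩
  1ℚ + t * (eval (oddBinomials n) M t + E)
    ≡⟨ cong (λ o → 1ℚ + t * (o + E)) (sym (eval-extend (oddBinomials n) M t (k>n⇒nCk≡0 (s≤s n≤2M)))) ⟩
  1ℚ + t * (eval (oddBinomials n) (suc M) t + E)
    ≡⟨ lemma t (eval (oddBinomials n) (suc M) t) E ⟩
  (1ℚ + t * E) + t * eval (oddBinomials n) (suc M) t ∎
  where
  open ≡-Reasoning
  E : ℚ
  E = eval (evenBinomials n ∘ suc) M t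
  lemma : ∀ t O E → 1ℚ + t * (O + E) ≡ (1ℚ + t * E) + t * O
  lemma = solve-∀ ℚ-ring

oddBinomials-noRationalRoot : ∀ {h} → Prime (suc (h ℕ.* 2)) → 2 ≤ h →
                              ∀ t → eval (oddBinomials (suc (h ℕ.* 2))) (suc h) t ≢ 0ℚ
oddBinomials-noRationalRoot {h} pr 2≤h = eisenstein (oddBinomials p) h pr 2≤h
  (λ j<h → prime∣pCk pr (s≤s z≤n) (s≤s (ℕ.*-monoˡ-< 2 j<h))) (nCn≡1 p) (nC1≡n p)
  where p = suc (h ℕ.* 2)

scaled-power : ∀ {d} a c n M → n ≤ suc (M ℕ.* 2) →
  _^K_ {d} (a + (a * c) √d) n
    ≡ (a ^ n * eval (evenBinomials n) (suc M) (c * c * (d ℚ./ 1)))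
      + (a ^ n * (c * eval (oddBinomials n) (suc M) (c * c * (d ℚ./ 1)))) √d
scaled-power {d} a c zero M _ = cong₂ _+_√d
  (trans (lemma₁ t) (cong (λ e → 1ℚ * (1ℚ + t * e)) (sym (eval-zeros M t))))
  (trans (lemma₂ c) (cong (λ e → 1ℚ * (c * e)) (sym (eval-zeros (suc M) t))))
  where
  t : ℚ
  t = c * c * (d ℚ./ 1)
  lemma₁ : ∀ t → 1ℚ ≡ 1ℚ * (1ℚ + t * 0ℚ)
  lemma₁ = solve-∀ ℚ-ring
  lemma₂ : ∀ c → 0ℚ ≡ 1ℚ * (c * 0ℚ)
  lemma₂ = solve-∀ ℚ-ring
scaled-power {d} a c (suc n) M (s≤s n≤2M) =
  trans (cong ((a + (a * c) √d) ⊗_) (scaled-power a c n M (ℕ.m≤n⇒m≤1+n n≤2M))) (cong₂ _+_√d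
    (trans (re-lemma a (a ^ n) c D E O) (cong ((a * a ^ n) *_) (sym (evenBinomials-suc n M t n≤2M))))
    (trans (im-lemma a (a ^ n) c E O) (cong (λ e → (a * a ^ n) * (c * e)) (sym (oddBinomials-suc n (suc M) t)))))
  where
  D : ℚ
  D = d ℚ./ 1
  t : ℚ
  t = c * c * D
  E : ℚ
  E = eval (evenBinomials n) (suc M) t
  O : ℚ
  O = eval (oddBinomials n) (suc M) t
  re-lemma : ∀ a aⁿ c D E O → a * (aⁿ * E) + D * ((a * c) * (aⁿ * (c * O)))
                              ≡ (a * aⁿ) * (E + (c * c * D) * O)
  re-lemma = solve-∀ ℚ-ring
  im-lemma : ∀ a aⁿ c E O → a * (aⁿ * (c * O)) + (a * c) * (aⁿ * E) ≡ (a * aⁿ) * (c * (E + O))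
  im-lemma = solve-∀ ℚ-ring

pure-power : ∀ {d} b h → _^K_ {d} (0ℚ + b √d) (suc (h ℕ.* 2)) ≡ 0ℚ + (b * (b * b * (d ℚ./ 1)) ^ h) √d
pure-power {d} b zero = cong₂ _+_√d (re-lemma b (d ℚ./ 1)) (im-lemma b)
  where
  re-lemma : ∀ b D → 0ℚ * 1ℚ + D * (b * 0ℚ) ≡ 0ℚ
  re-lemma = solve-∀ ℚ-ring
  im-lemma : ∀ b → 0ℚ * 0ℚ + b * 1ℚ ≡ b * 1ℚ
  im-lemma = solve-∀ ℚ-ring
pure-power {d} b (suc h) =
  trans (cong (λ y → x ⊗ (x ⊗ y)) (pure-power b h)) (cong₂ _+_√d (re-lemma b D eʰ) (im-lemma b D eʰ))
  where
  x : K d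
  x = 0ℚ + b √d
  D : ℚ
  D = d ℚ./ 1
  eʰ : ℚ
  eʰ = (b * b * D) ^ h
  re-lemma : ∀ b D eʰ → 0ℚ * (0ℚ * 0ℚ + D * (b * (b * eʰ))) + D * (b * (0ℚ * (b * eʰ) + b * 0ℚ)) ≡ 0ℚ
  re-lemma = solve-∀ ℚ-ring
  im-lemma : ∀ b D eʰ → 0ℚ * (0ℚ * (b * eʰ) + b * 0ℚ) + b * (0ℚ * 0ℚ + D * (b * (b * eʰ)))
                       ≡ b * ((b * b * D) * eʰ)
  im-lemma = solve-∀ ℚ-ring

im[x^p]≢0 : ∀ {d h} → d ≢ 0ℤ → Prime (suc (h ℕ.* 2)) → 2 ≤ h →
            ∀ a {b} → b ≢ 0ℚ → im (_^K_ {d} (a + b √d) (suc (h ℕ.* 2))) ≢ 0ℚ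
im[x^p]≢0 {d} {h} d≢0 pr 2≤h a {b} b≢0 with a ℚ.≟ 0ℚ
... | yes refl = subst (_≢ 0ℚ) (sym (cong im (pure-power b h)))
  (p≢0∧q≢0⇒p*q≢0 b≢0
    (p≢0⇒p^n≢0 h (p≢0∧q≢0⇒p*q≢0 (p≢0∧q≢0⇒p*q≢0 b≢0 b≢0) (i≢0⇒i/1≢0 d≢0))))
... | no a≢0 = subst (_≢ 0ℚ) (sym im≡aᵖcR)
  (p≢0∧q≢0⇒p*q≢0 (p≢0⇒p^n≢0 p a≢0)
    (p≢0∧q≢0⇒p*q≢0 c≢0 (oddBinomials-noRationalRoot pr 2≤h t)))
  where
  instance _ = ℚ.≢-nonZero a≢0
  p : ℕ
  p = suc (h ℕ.* 2)
  c : ℚ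
  c = 1/ a * b
  t : ℚ
  t = c * c * (d ℚ./ 1)

  a*c≡b : a * c ≡ b
  a*c≡b = begin
    a * (1/ a * b)  ≡⟨ sym (ℚ.*-assoc a (1/ a) b) ⟩
    (a * 1/ a) * b  ≡⟨ cong (_* b) (ℚ.*-inverseʳ a) ⟩
    1ℚ * b          ≡⟨ ℚ.*-identityˡ b ⟩
    b               ∎
    where open ≡-Reasoning

  c≢0 : c ≢ 0ℚ
  c≢0 c≡0 = b≢0 (trans (sym a*c≡b) (trans (cong (a *_) c≡0) (ℚ.*-zeroʳ a)))

  im≡aᵖcR : im (_^K_ {d} (a + b √d) p) ≡ a ^ p * (c * eval (oddBinomials p) (suc h) t)
  im≡aᵖcR = trans (cong (λ b → im (_^K_ {d} (a + b √d) p)) (sym a*c≡b))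
                  (cong im (scaled-power a c p h ℕ.≤-refl))

im[ι^n]≡0 : ∀ {d} q n → im (_^K_ {d} (ι q) n) ≡ 0ℚ
im[ι^n]≡0     q zero    = refl
im[ι^n]≡0 {d} q (suc n) = trans (cong (λ i → q * i + 0ℚ * re (_^K_ {d} (ι q) n)) (im[ι^n]≡0 q n))
                                (lemma q (re (_^K_ {d} (ι q) n)))
  where
  lemma : ∀ q r → q * 0ℚ + 0ℚ * r ≡ 0ℚ
  lemma = solve-∀ ℚ-ring

im[x^p]≡0⇔im[x]≡0 : ∀ {d p} → d ≢ 0ℤ → Prime p → p > 3 →
                    (x : K d) → im (x ^K p) ≡ 0ℚ ⇔ im x ≡ 0ℚ
im[x^p]≡0⇔im[x]≡0 d≢0 pr p>3 (a + b √d) with prime>3⇒odd pr p>3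
... | h , 2≤h , refl = mk⇔
  (λ im[x^p]≡0 → decidable-stable (b ℚ.≟ 0ℚ) (λ b≢0 → im[x^p]≢0 d≢0 pr 2≤h a b≢0 im[x^p]≡0))
  (λ { refl → im[ι^n]≡0 a (suc (h ℕ.* 2)) })

im[y⊗y]≡0⇔re*im≡0 : ∀ {d} (y : K d) → im (y ⊗ y) ≡ 0ℚ ⇔ re y * im y ≡ 0ℚ
im[y⊗y]≡0⇔re*im≡0 (m + n √d) = mk⇔
  (λ mn+nm≡0 → p+p≡0⇒p≡0 (m * n) (trans (cong (_+_ (m * n)) (ℚ.*-comm m n)) mn+nm≡0))
  (λ mn≡0 → trans (cong₂ _+_ mn≡0 (trans (ℚ.*-comm n m) mn≡0)) (ℚ.+-identityʳ 0ℚ))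

¬-cong-⇔ : ∀ {A B : Set} → A ⇔ B → (¬ A) ⇔ (¬ B)
¬-cong-⇔ A⇔B = mk⇔ (λ ¬A → ¬A ∘ Equivalence.from A⇔B) (λ ¬B → ¬B ∘ Equivalence.to A⇔B)

InQ⇔im≡0 : ∀ {d} (x : K d) → InQ x ⇔ im x ≡ 0ℚ
InQ⇔im≡0 x = mk⇔ (λ { (q , refl) → refl }) (λ im≡0 → re x , cong (re x +_√d) im≡0)

∃coordinates⇔ : ∀ {d} (P : ℚ → ℚ → Set) (x : K d) →
                (Σ ℚ λ a → Σ ℚ λ b → x ≡ (a + b √d) × P a b) ⇔ P (re x) (im x)
∃coordinates⇔ P x = mk⇔ (λ { (a , b , refl , Pab) → Pab }) (λ P[x] → re x , im x , refl , P[x])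

module ⇔-Reasoning = SetoidReasoning (⇔-setoid 0ℓ)

im[X]≡0⇔re[Y]*im[Y]≡0 : ∀ {d p α} → d ≢ 0ℤ → Prime p → p > 3 →
                         (X Y : K d) → Y ⊗ Y ≡ (X ^K p) ⊕ ι α →
                         im X ≡ 0ℚ ⇔ re Y * im Y ≡ 0ℚ
im[X]≡0⇔re[Y]*im[Y]≡0 {p = p} d≢0 pr p>3 X Y Y²≡Xᵖ+α = begin
  im X ≡ 0ℚ          ≈⟨ im[x^p]≡0⇔im[x]≡0 d≢0 pr p>3 X ⟨
  im (X ^K p) ≡ 0ℚ   ≈⟨ mk⇔ (trans im[Y²]≡im[Xᵖ]) (trans (sym im[Y²]≡im[Xᵖ])) ⟩
  im (Y ⊗ Y) ≡ 0ℚ    ≈⟨ im[y⊗y]≡0⇔re*im≡0 Y ⟩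
  re Y * im Y ≡ 0ℚ   ∎
  where
  open ⇔-Reasoning
  im[Y²]≡im[Xᵖ] : im (Y ⊗ Y) ≡ im (X ^K p)
  im[Y²]≡im[Xᵖ] = trans (cong im Y²≡Xᵖ+α) (ℚ.+-identityʳ (im (X ^K p)))

proposition4p1 : (d : ℤ) → SquareFree d → d ≢ 1ℤ →
    (p : ℕ) → Prime p → p > 3 →
    (α : ℚ) → (X Y : K d) → Y ⊗ Y ≡ (X ^K p) ⊕ ι α →
    (InQ X ⇔ (im Y ≡ 0ℚ ⊎ re Y ≡ 0ℚ))
    × ((Σ ℚ λ a → Σ ℚ λ b → X ≡ (a + b √d) × b ≢ 0ℚ)
       ⇔ (Σ ℚ λ m → Σ ℚ λ n → Y ≡ (m + n √d) × m * n ≢ 0ℚ))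
proposition4p1 d (d≢0 , _) _ p pr p>3 α X Y Y²≡Xᵖ+α = part-a , part-b
  where
  open ⇔-Reasoning

  im[X]≡0⇔reY*imY≡0 : im X ≡ 0ℚ ⇔ re Y * im Y ≡ 0ℚ
  im[X]≡0⇔reY*imY≡0 = im[X]≡0⇔re[Y]*im[Y]≡0 d≢0 pr p>3 X Y Y²≡Xᵖ+α

  part-a : InQ X ⇔ (im Y ≡ 0ℚ ⊎ re Y ≡ 0ℚ)
  part-a = begin
    InQ X                    ≈⟨ InQ⇔im≡0 X ⟩
    im X ≡ 0ℚ                ≈⟨ im[X]≡0⇔reY*imY≡0 ⟩
    re Y * im Y ≡ 0ℚ         ≈⟨ p*q≡0⇔q≡0∨p≡0 (re Y) (im Y) ⟩
    (im Y ≡ 0ℚ ⊎ re Y ≡ 0ℚ)  ∎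

  part-b : (Σ ℚ λ a → Σ ℚ λ b → X ≡ (a + b √d) × b ≢ 0ℚ)
           ⇔ (Σ ℚ λ m → Σ ℚ λ n → Y ≡ (m + n √d) × m * n ≢ 0ℚ)
  part-b = begin
    (Σ ℚ λ a → Σ ℚ λ b → X ≡ (a + b √d) × b ≢ 0ℚ)      ≈⟨ ∃coordinates⇔ (λ _ b → b ≢ 0ℚ) X ⟩
    im X ≢ 0ℚ                                          ≈⟨ ¬-cong-⇔ im[X]≡0⇔reY*imY≡0 ⟩
    re Y * im Y ≢ 0ℚ                                   ≈⟨ ∃coordinates⇔ (λ m n → m * n ≢ 0ℚ) Y ⟨
    (Σ ℚ λ m → Σ ℚ λ n → Y ≡ (m + n √d) × m * n ≢ 0ℚ) ∎
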